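{- Let $M$ be a closed lambda-term of sort $\mathsf{o}$ and complexity $0$, and let $v:\Sigma_{\mathsf{a}}\to\mathbb{N}$ be such that $\mathit{BT}(M)$ has a finite branch containing, for every $a\in\Sigma_{\mathsf{a}}$, exactly $v(a)$ occurrences of $a$. Then $\emptyset\vdash M:(v,\mathsf{r})$ is derivable.
   Context: Fix $s\ge1$. Sorts are built from $\mathsf{o}$ by $\to$; $\mathit{ord}(\mathsf{o})=0$, $\mathit{ord}(\alpha\to\beta)=\max(1+\mathit{ord}(\alpha),\mathit{ord}(\beta))$. Lambda-terms are infinitary simply-typed lambda-terms (coinductive), up to alpha-conversion, over constants $\mathsf{a}_1,\dots,\mathsf{a}_s:\mathsf{o}\to\mathsf{o}$ ($\Sigma_{\mathsf{a}}=\{\mathsf{a}_1,\dots,\mathsf{a}_s\}$), $\mathsf{b}:\mathsf{o}\to\mathsf{o}\to\mathsf{o}$, $\mathsf{c},\omega:\mathsf{o}$. The complexity of $M$ is the maximum of the orders of subterms of $M$ not of the form $a\,M_1\dots M_k$ with $a$ a constant, $k\ge0$ (or $0$ if none). Böhm trees: a tree is a term $a\,T_1\dots T_r$ with $a$ of arity $r$ and $T_i$ trees (coinductively). A finite branch of a tree $a\,T_1\dots T_r$ is a sequence of constants $a_1,\dots,a_k$ with $a_1=a\ne\omega$ and either $k\ge2$ and $a_2,\dots,a_k$ a finite branch of some $T_i$, or $r=0$ and $k=1$. For closed $M$ of sort $\mathsf{o}$: if $M$ beta-reduces to $a\,M_1\dots M_r$ with $a$ a constant, $\mathit{BT}(M)=a\,\mathit{BT}(M_1)\dots\mathit{BT}(M_r)$,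 otherwise $\omega$. An $s$-multiset is a multiset with at most $s$ copies of each element; $\mathcal{P}_{\le s}(X)$ is the set of such over $X$; the union $U\cup V$ has $\min(n+m,s)$ copies of an element occurring $n$ times in $U$ and $m$ in $V$; $\{x_i\mid i\in I\}$ means $\bigcup_{i\in I}\{x_i\}$. Types: $\mathcal{T}_s^{\mathsf{o}}=\{\mathsf{r}\}$, $\mathcal{T}_s^{\alpha\to\beta}=\mathcal{P}_{\le s}(\mathcal{P}(\Sigma_{\mathsf{a}})\times\mathcal{T}_s^\alpha)\times\mathcal{T}_s^\beta$, written $\bigwedge_{i\in I}(A_i,\tau_i)\to\tau$ (each pair at most $s$ times); $\top$ empty. Judgments $\Gamma\vdash M:(v,\tau)$ with $v:\Sigma_{\mathsf{a}}\to\mathbb{N}$; $\Gamma$ an $s$-multiset of bindings $x:(A,\sigma)$; $\mathit{dom}(\Gamma)$ the bound variables; $\Gamma{\restriction}_a$ the bindings whose set contains $a$; $\mathbf{0}$ constantly $0$; $\chi_i$ maps $\mathsf{a}_i$ to $1$, others to $0$; $\mathit{dupl}((\Gamma_j)_{j\in J})(a)=\sum_{j\in J}|\Gamma_j{\restriction}_a|-|\bigcup_{j\in J}\Gamma_j{\restriction}_a|$. Finite derivations use: $\emptyset\vdash\mathsf{a}_i:(\chi_i,(A,\mathsf{r})\to\mathsf{r})$; $\emptyset\vdash\mathsf{c}:(\mathbf{0},\mathsf{r})$; $\emptyset\vdash\mathsf{b}:(\mathbf{0},(A,\mathsf{r})\to\top\to\mathsf{r})$; $\emptyset\vdash\mathsf{b}:(\mathbf{0},\top\to(A,\mathsf{r})\to\mathsf{r})$;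 $x:(A,\tau)\vdash x:(\mathbf{0},\tau)$; ($\lambda$): from $\Gamma\cup\{x:(A_i,\tau_i)\mid i\in I\}\vdash K:(v,\tau)$, $x\notin\mathit{dom}(\Gamma)$, infer $\Gamma\vdash\lambda x.K:(v,\bigwedge_{i\in I}(A_i,\tau_i)\to\tau)$; ($@$): if $0\notin I$, $\Gamma_0\vdash K:(v_0,\bigwedge_{i\in I}(A_i,\tau_i)\to\tau)$, and $\Gamma_i\vdash L:(v_i,\tau_i)$ for $i\in I$ with $A_i=\{a\mid v_i(a)>0\lor\Gamma_i{\restriction}_a\ne\emptyset\}$, infer $\bigcup_{i\in\{0\}\cup I}\Gamma_i\vdash K\,L:(\mathit{dupl}((\Gamma_i)_{i\in\{0\}\cup I})+\sum_{i\in\{0\}\cup I}v_i,\tau)$. No rule for $\omega$. -}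

module Defs where

open import Data.Nat using (ℕ; zero; suc; _+_; _∸_; _⊓_; _⊔_; _≤_)
open import Data.Fin using (Fin; _≟_)
open import Data.Fin.Subset using (Subset; _∈_)
open import Data.Fin.Subset.Properties using (_∈?_)
open import Data.List using (List; []; _∷_; _++_; [_]; length; map; filter; tabulate)
open import Data.Nat.ListAction using (sum)
open import Data.List.Relation.Binary.Pointwise using (Pointwise)
open import Data.List.Relation.Binary.Permutation.Homogeneous using (Permutation)
open import Data.Product using (Σ; _×_; _,_; proj₁; proj₂)
open import Data.Bool using (Bool; true; false; _∨_; if_then_else_)
open import Data.Unit using (⊤)
import Data.Vec as Vec
open import Relation.Nullary using (¬_; does)
open import Relation.Binary.PropositionalEquality using (_≡_; _≢_)
open import Relation.Binary.Construct.Closure.ReflexiveTransitive using (Star)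

infixr 7 _⇒_
data Sort : Set where
  o   : Sort
  _⇒_ : Sort → Sort → Sort

ord : Sort → ℕ
ord o       = 0
ord (α ⇒ β) = suc (ord α) ⊔ ord β

data Const (s : ℕ) : Set where
  𝐚 : Fin s → Const s
  𝐛 𝐜 ω : Const s

arity : ∀ {s} → Const s → ℕ
arity (𝐚 _) = 1
arity 𝐛     = 2
arity 𝐜     = 0
arity ω     = 0

arrows : ℕ → Sort
arrows zero    = o
arrows (suc n) = o ⇒ arrows n

sortOf : ∀ {s} → Const s → Sort
sortOf k = arrows (arity k)

-- Infinitary simply-typed lambda-terms (coinductive), de Bruijn indices,
-- intrinsically sorted
-- (so terms are taken up to alpha-conversion)

Ctx : Set
Ctx = List Sort

data _∋_ : Ctx → Sort → Set where
  here  : ∀ {Γ α} → (α ∷ Γ) ∋ α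
  there : ∀ {Γ α β} → Γ ∋ α → (β ∷ Γ) ∋ α

mutual
  record Term (s : ℕ) (Γ : Ctx) (α : Sort) : Set where
    coinductive
    field node : Node s Γ α

  data Node (s : ℕ) (Γ : Ctx) : Sort → Set where
    con : (k : Const s) → Node s Γ (sortOf k)
    var : ∀ {α} → Γ ∋ α → Node s Γ α
    lam : ∀ {α β} → Term s (α ∷ Γ) β → Node s Γ (α ⇒ β)
    app : ∀ {α β} → Term s Γ (α ⇒ β) → Term s Γ α → Node s Γ β

open Term public

-- Since the terms are infinitary (coinductive),
-- renaming/substitution are given as coinductive relations:
-- RenR ρ t t′ : t′ is (a term bisimilar to) t renamed by ρ,
-- SubstR σ t t′ : t′ is t with its variables x replaced by terms u with σ x u.

Ren : Ctx → Ctx → Set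
Ren Γ Δ = ∀ {α} → Γ ∋ α → Δ ∋ α

ext : ∀ {Γ Δ β} → Ren Γ Δ → Ren (β ∷ Γ) (β ∷ Δ)
ext ρ here      = here
ext ρ (there x) = there (ρ x)

mutual
  record RenR {s Γ Δ α} (ρ : Ren Γ Δ) (t : Term s Γ α) (t′ : Term s Δ α) : Set where
    coinductive
    field renStep : RenN ρ (node t) (node t′)

  data RenN {s Γ Δ} (ρ : Ren Γ Δ) : ∀ {α} → Node s Γ α → Node s Δ α → Set where
    rcon : ∀ {k} → RenN ρ (con k) (con k)
    rvar : ∀ {α} {x : Γ ∋ α} → RenN ρ (var x) (var (ρ x))
    rlam : ∀ {α β} {K : Term s (α ∷ Γ) β} {K′} →
           RenR (ext ρ) K K′ → RenN ρ (lam K) (lam K′)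
    rapp : ∀ {α β} {K : Term s Γ (α ⇒ β)} {K′} {L : Term s Γ α} {L′} →
           RenR ρ K K′ → RenR ρ L L′ → RenN ρ (app K L) (app K′ L′)

SubR : ℕ → Ctx → Ctx → Set₁
SubR s Γ Δ = ∀ {α} → Γ ∋ α → Term s Δ α → Set

extsR : ∀ {s Γ Δ β} → SubR s Γ Δ → SubR s (β ∷ Γ) (β ∷ Δ)
extsR σ here      t = node t ≡ var here
extsR σ (there x) t = Σ _ λ u → σ x u × RenR there u t

mutual
  record SubstR {s Γ Δ α} (σ : SubR s Γ Δ) (t : Term s Γ α) (t′ : Term s Δ α) : Set where
    coinductive
    field substStep : SubstN σ (node t) t′

  data SubstN {s Γ Δ} (σ : SubR s Γ Δ) : ∀ {α} → Node s Γ α → Term s Δ α → Set where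
    scon : ∀ {k} {t′ : Term s Δ (sortOf k)} → node t′ ≡ con k → SubstN σ (con k) t′
    svar : ∀ {α} {x : Γ ∋ α} {t′} → σ x t′ → SubstN σ (var x) t′
    slam : ∀ {α β} {K : Term s (α ∷ Γ) β} {K′} {t′ : Term s Δ (α ⇒ β)} →
           node t′ ≡ lam K′ → SubstR (extsR σ) K K′ → SubstN σ (lam K) t′
    sapp : ∀ {α β} {K : Term s Γ (α ⇒ β)} {K′} {L : Term s Γ α} {L′} {t′ : Term s Δ β} →
           node t′ ≡ app K′ L′ → SubstR σ K K′ → SubstR σ L L′ → SubstN σ (app K L) t′

sub₀R : ∀ {s Γ α} → Term s Γ α → SubR s (α ∷ Γ) Γ
sub₀R L here      t = t ≡ L
sub₀R L (there x) t = node t ≡ var x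

-- one-step beta-reduction at any (finite-depth) position
infix 4 _⟶_
data _⟶_ {s Γ} : ∀ {α} → Term s Γ α → Term s Γ α → Set where
  β-red : ∀ {α β} {M N : Term s Γ β} {K : Term s Γ (α ⇒ β)} {L : Term s Γ α}
            {B : Term s (α ∷ Γ) β} →
          node M ≡ app K L → node K ≡ lam B → SubstR (sub₀R L) B N → M ⟶ N
  ξ-lam : ∀ {α β} {M N : Term s Γ (α ⇒ β)} {K K′ : Term s (α ∷ Γ) β} →
          node M ≡ lam K → K ⟶ K′ → node N ≡ lam K′ → M ⟶ N
  ξ-fun : ∀ {α β} {M N : Term s Γ β} {K K′ : Term s Γ (α ⇒ β)} {L : Term s Γ α} →
          node M ≡ app K L → K ⟶ K′ → node N ≡ app K′ L → M ⟶ N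
  ξ-arg : ∀ {α β} {M N : Term s Γ β} {K : Term s Γ (α ⇒ β)} {L L′ : Term s Γ α} →
          node M ≡ app K L → L ⟶ L′ → node N ≡ app K L′ → M ⟶ N

_⟶*_ : ∀ {s Γ α} → Term s Γ α → Term s Γ α → Set
_⟶*_ = Star _⟶_

data IsConApp {s Γ} : ∀ {α} → Node s Γ α → Set where
  isCon : ∀ {k} → IsConApp (con k)
  isApp : ∀ {α β} {K : Term s Γ (α ⇒ β)} {L : Term s Γ α} →
          IsConApp (node K) → IsConApp (app K L)

data Subterm {s Δ β} (N : Term s Δ β) : ∀ {Γ α} → Term s Γ α → Set where
  here  : Subterm N N
  inLam : ∀ {Γ α γ} {M : Term s Γ (α ⇒ γ)} {K : Term s (α ∷ Γ) γ} →
          node M ≡ lam K → Subterm N K → Subterm N M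
  inFun : ∀ {Γ α γ} {M : Term s Γ γ} {K : Term s Γ (α ⇒ γ)} {L : Term s Γ α} →
          node M ≡ app K L → Subterm N K → Subterm N M
  inArg : ∀ {Γ α γ} {M : Term s Γ γ} {K : Term s Γ (α ⇒ γ)} {L : Term s Γ α} →
          node M ≡ app K L → Subterm N L → Subterm N M

ComplexityAtMost : ∀ {s Γ α} → ℕ → Term s Γ α → Set
ComplexityAtMost {s} n M =
  ∀ {Δ β} (N : Term s Δ β) → Subterm N M → ¬ IsConApp (node N) → ord β ≤ n

record Tree (s : ℕ) : Set where
  coinductive
  field
    root : Const s
    kids : Fin (arity root) → Tree s

open Tree public

data IsConN {s Γ} (k : Const s) : ∀ {α} → Node s Γ α → Set where
  isConN : IsConN k (con k)

data HeadApp {s Γ} (k : Const s) : ∀ {α} → Term s Γ α → List (Term s Γ o) → Set where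
  hd : ∀ {α} {N : Term s Γ α} → IsConN k (node N) → HeadApp k N []
  ap : ∀ {α} {N : Term s Γ α} {K : Term s Γ (o ⇒ α)} {L : Term s Γ o} {ts} →
       node N ≡ app K L → HeadApp k K ts → HeadApp k N (ts ++ [ L ])

mutual
  record IsBT {s} (M : Term s [] o) (T : Tree s) : Set where
    coinductive
    field unfoldBT : BTStep M T

  data BTStep {s} (M : Term s [] o) (T : Tree s) : Set where
    hnf  : ∀ {N ts} → M ⟶* N → HeadApp (root T) N ts →
           Pointwise IsBT ts (tabulate (kids T)) → BTStep M T
    none : (∀ N k ts → M ⟶* N → ¬ HeadApp k N ts) → root T ≡ ω → BTStep M T

open IsBT public

data FinBranch {s} : Tree s → List (Const s) → Set where
  leaf : ∀ {T} → root T ≢ ω → arity (root T) ≡ 0 → FinBranch T [ root T ]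
  step : ∀ {T bs} → root T ≢ ω → (i : Fin (arity (root T))) →
         FinBranch (kids T i) bs → FinBranch T (root T ∷ bs)

occ : ∀ {s} → Fin s → List (Const s) → ℕ
occ i []            = 0
occ i (𝐚 j ∷ ks)    = (if does (j ≟ i) then 1 else 0) + occ i ks
occ i (𝐛 ∷ ks)      = occ i ks
occ i (𝐜 ∷ ks)      = occ i ks
occ i (ω ∷ ks)      = occ i ks

-- s-multisets, represented by lists, relative to an equivalence R

data Count {X : Set} (R : X → X → Set) (x : X) : List X → ℕ → Set where
  nil  : Count R x [] 0
  hit  : ∀ {y ys n} → R x y → Count R x ys n → Count R x (y ∷ ys) (suc n)
  miss : ∀ {y ys n} → ¬ R x y → Count R x ys n → Count R x (y ∷ ys) n

AtMost : {X : Set} → (X → X → Set) → ℕ → List X → Set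
AtMost R s L = ∀ x n → Count R x L n → n ≤ s

-- W represents the capped union ⋃ Us (min(Σ multiplicities, s) copies)
CapUnion : {X : Set} → (X → X → Set) → ℕ → List (List X) → List X → Set
CapUnion R s Us W =
  ∀ x ns → Pointwise (Count R x) Us ns → Count R x W (sum ns ⊓ s)

infixr 7 _↦_
data Ty (s : ℕ) : Sort → Set where
  r   : Ty s o
  _↦_ : ∀ {α β} → List (Subset s × Ty s α) → Ty s β → Ty s (α ⇒ β)

-- ⊤ (the empty intersection)
⊤ᵗ : ∀ {s α β} → Ty s β → Ty s (α ⇒ β)
⊤ᵗ τ = [] ↦ τ

mutual
  data _≈T_ {s} : ∀ {α} → Ty s α → Ty s α → Set where
    r≈ : r ≈T r
    ↦≈ : ∀ {α β} {I J : List (Subset s × Ty s α)} {τ τ′ : Ty s β} →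
         Permutation _≈P_ I J → τ ≈T τ′ → (I ↦ τ) ≈T (J ↦ τ′)

  data _≈P_ {s α} : Subset s × Ty s α → Subset s × Ty s α → Set where
    pair≈ : ∀ {A τ τ′} → τ ≈T τ′ → (A , τ) ≈P (A , τ′)

mutual
  WfTy : ∀ {s α} → Ty s α → Set
  WfTy r = ⊤
  WfTy {s} (I ↦ τ) = WfL I × AtMost _≈P_ s I × WfTy τ

  WfL : ∀ {s α} → List (Subset s × Ty s α) → Set
  WfL []            = ⊤
  WfL ((A , τ) ∷ I) = WfTy τ × WfL I

Binding : ℕ → Ctx → Set
Binding s Δ = Σ Sort λ σ → (Δ ∋ σ) × Subset s × Ty s σ

data _≈B_ {s Δ} : Binding s Δ → Binding s Δ → Set where
  bind≈ : ∀ {σ x A} {τ τ′ : Ty s σ} → τ ≈T τ′ → (σ , x , A , τ) ≈B (σ , x , A , τ′)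

Env : ℕ → Ctx → Set
Env s Δ = List (Binding s Δ)

_≈E_ : ∀ {s Δ} → Env s Δ → Env s Δ → Set
_≈E_ = Permutation _≈B_

wkB : ∀ {s Δ β} → Binding s Δ → Binding s (β ∷ Δ)
wkB (σ , x , A , τ) = (σ , there x , A , τ)

restrict : ∀ {s Δ} → Fin s → Env s Δ → Env s Δ
restrict a = filter (λ bd → a ∈? proj₁ (proj₂ (proj₂ bd)))

Val : ℕ → Set
Val s = Fin s → ℕ

𝟎 : ∀ {s} → Val s
𝟎 _ = 0

χ : ∀ {s} → Fin s → Val s
χ i a = if does (a ≟ i) then 1 else 0

pos : ℕ → Bool
pos zero    = false
pos (suc _) = true

nonempty : {X : Set} → List X → Bool
nonempty []      = false
nonempty (_ ∷ _) = true

mark : ∀ {s Δ} → Val s → Env s Δ → Subset s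
mark v Γ = Vec.tabulate (λ a → pos (v a) ∨ nonempty (restrict a Γ))

dupl : ∀ {s Δ} → List (Env s Δ) → (Fin s → Env s Δ) → Val s
dupl Γs W a = sum (map (λ G → length (restrict a G)) Γs) ∸ length (W a)

infix 3 _⊢_⦂⟨_,_⟩
mutual
  data _⊢_⦂⟨_,_⟩ {s} : ∀ {Δ α} → Env s Δ → Term s Δ α → Val s → Ty s α → Set where
    ⊢a   : ∀ {Δ} {M : Term s Δ (o ⇒ o)} {i A} → node M ≡ con (𝐚 i) →
           [] ⊢ M ⦂⟨ χ i , [ (A , r) ] ↦ r ⟩
    ⊢c   : ∀ {Δ} {M : Term s Δ o} → node M ≡ con 𝐜 →
           [] ⊢ M ⦂⟨ 𝟎 , r ⟩
    ⊢b₁  : ∀ {Δ} {M : Term s Δ (o ⇒ o ⇒ o)} {A} → node M ≡ con 𝐛 →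
           [] ⊢ M ⦂⟨ 𝟎 , [ (A , r) ] ↦ ⊤ᵗ r ⟩
    ⊢b₂  : ∀ {Δ} {M : Term s Δ (o ⇒ o ⇒ o)} {A} → node M ≡ con 𝐛 →
           [] ⊢ M ⦂⟨ 𝟎 , ⊤ᵗ ([ (A , r) ] ↦ r) ⟩
    ⊢var : ∀ {Δ σ} {M : Term s Δ σ} {x : Δ ∋ σ} {A} {τ : Ty s σ} →
           node M ≡ var x → WfTy τ →
           [ (σ , x , A , τ) ] ⊢ M ⦂⟨ 𝟎 , τ ⟩
    ⊢lam : ∀ {Δ α β} {M : Term s Δ (α ⇒ β)} {K : Term s (α ∷ Δ) β}
             {Γ : Env s Δ} {Γ′ : Env s (α ∷ Δ)} {I : List (Subset s × Ty s α)}
             {v : Val s} {τ : Ty s β} →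
           node M ≡ lam K → WfTy (I ↦ τ) →
           CapUnion _≈B_ s (map wkB Γ ∷ map (λ p → [ (α , here , p) ]) I) Γ′ →
           Γ′ ⊢ K ⦂⟨ v , τ ⟩ →
           Γ ⊢ M ⦂⟨ v , I ↦ τ ⟩
    ⊢app : ∀ {Δ α β} {M : Term s Δ β} {K : Term s Δ (α ⇒ β)} {L : Term s Δ α}
             {Γ Γ₀ : Env s Δ} {Γs : List (Env s Δ)} {I : List (Subset s × Ty s α)}
             {v₀ : Val s} {vs : List (Val s)} {τ : Ty s β} →
           node M ≡ app K L →
           Γ₀ ⊢ K ⦂⟨ v₀ , I ↦ τ ⟩ →
           Args L I Γs vs →
           CapUnion _≈B_ s (Γ₀ ∷ Γs) Γ →
           (W : Fin s → Env s Δ) →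
           (∀ a → CapUnion _≈B_ s (map (restrict a) (Γ₀ ∷ Γs)) (W a)) →
           Γ ⊢ M ⦂⟨ (λ a → dupl (Γ₀ ∷ Γs) W a + sum (map (λ w → w a) (v₀ ∷ vs))) , τ ⟩
    -- judgments are about multisets and functions: representatives may be changed
    conv : ∀ {Δ α} {M : Term s Δ α} {Γ Γ′ : Env s Δ} {v v′ : Val s} {τ τ′ : Ty s α} →
           Γ ⊢ M ⦂⟨ v , τ ⟩ → Γ ≈E Γ′ → (∀ a → v a ≡ v′ a) → τ ≈T τ′ →
           Γ′ ⊢ M ⦂⟨ v′ , τ′ ⟩

  data Args {s Δ α} (L : Term s Δ α) :
       List (Subset s × Ty s α) → List (Env s Δ) → List (Val s) → Set where
    []  : Args L [] [] []
    _∷_ : ∀ {A τ Γi vi I Γs vs} →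
          (Γi ⊢ L ⦂⟨ vi , τ ⟩) × (A ≡ mark vi Γi) →
          Args L I Γs vs → Args L ((A , τ) ∷ I) (Γi ∷ Γs) (vi ∷ vs)

-- A term of complexity 0 contains no λ-abstraction (an abstraction has positive order and is not
-- a constant application), so it admits no β-step and its Böhm tree is read off its syntax: every
-- node of BT(M) is a constant applied to subterms of M.  Following the finite branch down these
-- subterms, a derivation is built bottom-up from the rules for c, aᵢ and b (choosing the version of
-- the b rule that types the argument on the branch and ignores the other), each aᵢ on the branch
-- adding χᵢ to the counter.
module Submission where

open import Defs
open import Data.Nat using (ℕ; _≤_; zero; suc; _+_; s≤s)
open import Data.Nat.Properties using (+-identityʳ; m≤m⊔n; ≤-trans; ≤-reflexive; <⇒≤)
open import Data.Fin using (Fin; _≟_) renaming (zero to fzero; suc to fsuc)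
open import Data.Fin.Subset using (Subset)
open import Data.List using (List; []; _∷_; [_]; replicate; tabulate)
open import Data.List.Relation.Binary.Pointwise using (Pointwise; []; _∷_)
open import Data.List.Relation.Binary.Permutation.Homogeneous using (Permutation)
open import Data.Product using (∃-syntax; _×_; _,_)
open import Data.Bool using (if_then_else_)
open import Data.Empty using (⊥-elim)
open import Relation.Nullary using (¬_; yes; no; does)
open import Relation.Binary.PropositionalEquality using (_≡_; _≢_; refl; sym; cong)
open import Relation.Binary.Construct.Closure.ReflexiveTransitive using (ε; _◅_)

private
  variable
    s : ℕ
    Δ : Ctx
    α β : Sort

Subterm-trans : ∀ {Γ Γ′ Γ″ α′ α″} {N : Term s Γ″ α″} {K : Term s Γ′ α′} {M : Term s Γ α} →
                Subterm N K → Subterm K M → Subterm N M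
Subterm-trans p here        = p
Subterm-trans p (inLam e q) = inLam e (Subterm-trans p q)
Subterm-trans p (inFun e q) = inFun e (Subterm-trans p q)
Subterm-trans p (inArg e q) = inArg e (Subterm-trans p q)

LamFree : Term s Δ α → Set
LamFree {s} M = ∀ {Γ α β} {K : Term s Γ (α ⇒ β)} {B} → Subterm K M → node K ≢ lam B

LamFree-subterm : ∀ {Γ γ} {K : Term s Γ γ} {M : Term s Δ α} → LamFree M → Subterm K M → LamFree K
LamFree-subterm free sub p = free (Subterm-trans p sub)

ord⇒≰0 : ¬ ord (α ⇒ β) ≤ 0
ord⇒≰0 {α} {β} p with ≤-trans (m≤m⊔n (suc (ord α)) (ord β)) p
... | ()

lam-¬IsConApp : ∀ {B : Term s (α ∷ Δ) β} {n : Node s Δ (α ⇒ β)} → n ≡ lam B → ¬ IsConApp n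
lam-¬IsConApp refl ()

complexity0⇒LamFree : {M : Term s Δ α} → ComplexityAtMost 0 M → LamFree M
complexity0⇒LamFree cx {α = α} {β} {K} sub eq = ord⇒≰0 {α} {β} (cx K sub (lam-¬IsConApp eq))

LamFree⇒¬⟶ : {M N : Term s Δ α} → LamFree M → ¬ M ⟶ N
LamFree⇒¬⟶ free (β-red eqM eqK _) = free (inFun eqM here) eqK
LamFree⇒¬⟶ free (ξ-lam eqM _ _)   = free here eqM
LamFree⇒¬⟶ free (ξ-fun eqM st _)  = LamFree⇒¬⟶ (LamFree-subterm free (inFun eqM here)) st
LamFree⇒¬⟶ free (ξ-arg eqM st _)  = LamFree⇒¬⟶ (LamFree-subterm free (inArg eqM here)) st

LamFree⇒⟶*-≡ : {M N : Term s Δ α} → LamFree M → M ⟶* N → M ≡ N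
LamFree⇒⟶*-≡ free ε        = refl
LamFree⇒⟶*-≡ free (st ◅ _) = ⊥-elim (LamFree⇒¬⟶ free st)

BT-head : ∀ {M : Term s [] o} {T} → LamFree M → IsBT M T → root T ≢ ω →
          ∃[ ts ] HeadApp (root T) M ts × Pointwise IsBT ts (tabulate (kids T))
BT-head free bt root≢ω with unfoldBT bt
... | hnf M⟶*N h pw with refl ← LamFree⇒⟶*-≡ free M⟶*N = _ , h , pw
... | none _ root≡ω = ⊥-elim (root≢ω root≡ω)

arrowCount : Sort → ℕ
arrowCount o       = 0
arrowCount (α ⇒ β) = suc (arrowCount β)

arrowCount-arrows : ∀ n → arrowCount (arrows n) ≡ n
arrowCount-arrows zero    = refl
arrowCount-arrows (suc n) = cong suc (arrowCount-arrows n)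

IsConN-arrowCount : ∀ {k : Const s} {n : Node s Δ α} → IsConN k n → arrowCount α ≡ arity k
IsConN-arrowCount {k = k} isConN = arrowCount-arrows (arity k)

IsConN-≡ : ∀ {k : Const s} {n : Node s Δ (sortOf k)} → IsConN k n → n ≡ con k
IsConN-≡ isConN = refl

HeadApp-arrowCount : ∀ {k : Const s} {N : Term s Δ α} {ts} → HeadApp k N ts → arrowCount α ≤ arity k
HeadApp-arrowCount (hd p)   = ≤-reflexive (IsConN-arrowCount p)
HeadApp-arrowCount (ap _ h) = <⇒≤ (HeadApp-arrowCount h)

data Applied𝐚 (j : Fin s) (M : Term s Δ o) : List (Term s Δ o) → Set where
  app𝐚 : ∀ {K L} → node M ≡ app K L → node K ≡ con (𝐚 j) → Applied𝐚 j M [ L ]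

data Applied𝐛 (M : Term s Δ o) : List (Term s Δ o) → Set where
  app𝐛 : ∀ {K B L₁ L₂} → node M ≡ app K L₂ → node K ≡ app B L₁ → node B ≡ con 𝐛 →
         Applied𝐛 M (L₁ ∷ L₂ ∷ [])

HeadApp-𝐚 : ∀ {j} {M : Term s Δ o} {ts} → HeadApp (𝐚 j) M ts → Applied𝐚 j M ts
HeadApp-𝐚 (hd p) with IsConN-arrowCount p
... | ()
HeadApp-𝐚 (ap eq (hd p)) = app𝐚 eq (IsConN-≡ p)
HeadApp-𝐚 (ap _ (ap _ h)) with HeadApp-arrowCount h
... | s≤s ()

HeadApp-𝐛 : ∀ {M : Term s Δ o} {ts} → HeadApp 𝐛 M ts → Applied𝐛 M ts
HeadApp-𝐛 (hd p) with IsConN-arrowCount p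
... | ()
HeadApp-𝐛 (ap _ (hd p)) with IsConN-arrowCount p
... | ()
HeadApp-𝐛 (ap eqM (ap eqK (hd p))) = app𝐛 eqM eqK (IsConN-≡ p)
HeadApp-𝐛 (ap _ (ap _ (ap _ h))) with HeadApp-arrowCount h
... | s≤s (s≤s ())

HeadApp-𝐜 : ∀ {M : Term s Δ o} {ts} → HeadApp 𝐜 M ts → node M ≡ con 𝐜
HeadApp-𝐜 (hd p)   = IsConN-≡ p
HeadApp-𝐜 (ap _ h) with HeadApp-arrowCount h
... | ()

mutual
  ≈T-refl : (τ : Ty s α) → τ ≈T τ
  ≈T-refl r       = r≈
  ≈T-refl (I ↦ τ) = ↦≈ (Permutation.refl (≈P-refl I)) (≈T-refl τ)

  ≈P-refl : (I : List (Subset s × Ty s α)) → Pointwise _≈P_ I I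
  ≈P-refl []            = []
  ≈P-refl ((_ , τ) ∷ I) = pair≈ (≈T-refl τ) ∷ ≈P-refl I

CapUnion-replicate-[] : ∀ {X : Set} {R : X → X → Set} {s} n → CapUnion R s (replicate n []) []
CapUnion-replicate-[] zero    _ []       []         = nil
CapUnion-replicate-[] (suc n) x (_ ∷ ns) (nil ∷ pw) = CapUnion-replicate-[] n x ns pw

⊢-value-cong : ∀ {M : Term s Δ α} {v v′ τ} → [] ⊢ M ⦂⟨ v , τ ⟩ → (∀ a → v a ≡ v′ a) → [] ⊢ M ⦂⟨ v′ , τ ⟩
⊢-value-cong {τ = τ} ⊢M v≗v′ = conv ⊢M (Permutation.refl []) v≗v′ (≈T-refl τ)

⊢app₁ : ∀ {M : Term s Δ β} {K : Term s Δ (α ⇒ β)} {L u v σ τ} → node M ≡ app K L →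
        [] ⊢ K ⦂⟨ u , [ (mark {Δ = Δ} v [] , σ) ] ↦ τ ⟩ → [] ⊢ L ⦂⟨ v , σ ⟩ →
        [] ⊢ M ⦂⟨ (λ a → u a + v a) , τ ⟩
⊢app₁ {u = u} {v} eq ⊢K ⊢L =
  ⊢-value-cong (⊢app eq ⊢K ((⊢L , refl) ∷ []) (CapUnion-replicate-[] 2) (λ _ → []) (λ _ → CapUnion-replicate-[] 2))
               (λ a → cong (u a +_) (+-identityʳ (v a)))

⊢app₀ : ∀ {M : Term s Δ β} {K : Term s Δ (α ⇒ β)} {L u τ} → node M ≡ app K L →
        [] ⊢ K ⦂⟨ u , ⊤ᵗ τ ⟩ → [] ⊢ M ⦂⟨ u , τ ⟩
⊢app₀ {u = u} eq ⊢K =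
  ⊢-value-cong (⊢app eq ⊢K [] (CapUnion-replicate-[] 1) (λ _ → []) (λ _ → CapUnion-replicate-[] 1))
               (λ a → +-identityʳ (u a))

occᵛ : List (Const s) → Val s
occᵛ bs a = occ a bs

does-≟-sym : (i j : Fin s) → does (i ≟ j) ≡ does (j ≟ i)
does-≟-sym i j with i ≟ j | j ≟ i
... | yes _   | yes _   = refl
... | no _    | no _    = refl
... | yes i≡j | no j≢i  = ⊥-elim (j≢i (sym i≡j))
... | no i≢j  | yes j≡i = ⊥-elim (i≢j (sym j≡i))

χ+occ : ∀ (j a : Fin s) bs → χ j a + occ a bs ≡ occ a (𝐚 j ∷ bs)
χ+occ j a bs = cong (λ b → (if b then 1 else 0) + occ a bs) (does-≟-sym a j)

⊢-head-leaf : ∀ {k} {M : Term s Δ o} {ts} → k ≢ ω → arity k ≡ 0 → HeadApp k M ts →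
              [] ⊢ M ⦂⟨ occᵛ [ k ] , r ⟩
⊢-head-leaf {k = 𝐜} _   _  h = ⊢c (HeadApp-𝐜 h)
⊢-head-leaf {k = ω} k≢ω _  _ = ⊥-elim (k≢ω refl)
⊢-head-leaf {k = 𝐚 _} _ () _
⊢-head-leaf {k = 𝐛} _   () _

⊢-head-step : ∀ {k} {M : Term s [] o} {ts} {kd : Fin (arity k) → Tree s} {bs} → HeadApp k M ts →
              Pointwise IsBT ts (tabulate kd) → (i : Fin (arity k)) →
              (∀ {L} → Subterm L M → IsBT L (kd i) → [] ⊢ L ⦂⟨ occᵛ bs , r ⟩) →
              [] ⊢ M ⦂⟨ occᵛ (k ∷ bs) , r ⟩
⊢-head-step {k = 𝐚 j} {bs = bs} h pw fzero IH with HeadApp-𝐚 h | pw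
... | app𝐚 eqM eqK | bt ∷ [] =
  ⊢-value-cong (⊢app₁ eqM (⊢a eqK) (IH (inArg eqM here) bt)) (λ a → χ+occ j a bs)
⊢-head-step {k = 𝐛} h pw fzero IH with HeadApp-𝐛 h | pw
... | app𝐛 eqM eqK eqB | bt ∷ _ =
  ⊢app₀ eqM (⊢app₁ eqK (⊢b₁ eqB) (IH (inFun eqM (inArg eqK here)) bt))
⊢-head-step {k = 𝐛} h pw (fsuc fzero) IH with HeadApp-𝐛 h | pw
... | app𝐛 eqM eqK eqB | _ ∷ bt ∷ [] =
  ⊢app₁ eqM (⊢app₀ eqK (⊢b₂ eqB)) (IH (inArg eqM here) bt)

⊢-branch : ∀ {M : Term s [] o} {T bs} → LamFree M → IsBT M T → FinBranch T bs → [] ⊢ M ⦂⟨ occᵛ bs , r ⟩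
⊢-branch free bt (leaf root≢ω ar) with BT-head free bt root≢ω
... | _ , h , _ = ⊢-head-leaf root≢ω ar h
⊢-branch free bt (step root≢ω i fb) with BT-head free bt root≢ω
... | _ , h , pw = ⊢-head-step h pw i (λ sub btL → ⊢-branch (LamFree-subterm free sub) btL fb)

lemma18 : (s : ℕ) → 1 ≤ s →
          (M : Term s [] o) → ComplexityAtMost 0 M →
          (v : Fin s → ℕ) →
          (T : Tree s) → IsBT M T →
          (bs : List (Const s)) → FinBranch T bs → (∀ i → occ i bs ≡ v i) →
          [] ⊢ M ⦂⟨ v , r ⟩
lemma18 s _ M cx v T bt bs fb occ≡v =
  ⊢-value-cong (⊢-branch (complexity0⇒LamFree cx) bt fb) occ≡v
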